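{- Let $d\ge2$, $\mathbf m=(m_1,\dots,m_d)\in\mathbb Z^d$, and let $\widetilde{\mathbf m}=(\widetilde m_1,\dots,\widetilde m_d)$ be the components of $\mathbf m$ in ascending order. Let $M=\lfloor\frac{d+1}2\rfloor+1$. Let $C(\mathbf m)=\min_{i\in[d]}\sum_{j\ne i}|m_i-m_j|$, and let $\mathbf e(i)$ be the $i$-th standard basis vector. Then for each $i\in[d]$: (1) $C(\mathbf m+\mathbf e(i))=C(\mathbf m)+1$ if $m_i\ge\widetilde m_M$; (2) $C(\mathbf m+\mathbf e(i))=C(\mathbf m)-1$ if either $d$ is even and $m_i<\widetilde m_M$, or $d$ is odd and $m_i<\widetilde m_{M-1}$; (3) $C(\mathbf m+\mathbf e(i))=C(\mathbf m)$ if $d$ is odd and $m_i=\widetilde m_{M-1}<\widetilde m_M$. In particular, $C(\mathbf m+\mathbf e(i))-C(\mathbf m)\in\{ -1,0,1\}$.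
   Context: $[d]=\{1,\dots,d\}$. -}

module Defs where

open import Data.Nat as ℕ using (ℕ; zero; suc)
open import Data.Integer using (ℤ; +_; _+_; _-_; ∣_∣; _⊓_; 0ℤ; 1ℤ)
open import Data.Fin using (Fin; _≟_)
open import Relation.Nullary using (yes; no)

sumFin : ∀ n → (Fin n → ℤ) → ℤ
sumFin zero    f = 0ℤ
sumFin (suc n) f = f Fin.zero + sumFin n (λ j → f (Fin.suc j))

-- minimum over Fin n (convention: 0 for n = 0; never used since d ≥ 2)
minFin : ∀ n → (Fin n → ℤ) → ℤ
minFin zero          f = 0ℤ
minFin (suc zero)    f = f Fin.zero
minFin (suc (suc n)) f = f Fin.zero ⊓ minFin (suc n) (λ j → f (Fin.suc j))

e : ∀ {d} → Fin d → Fin d → ℤ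
e i j with j ≟ i
... | yes _ = 1ℤ
... | no  _ = 0ℤ

_⊕_ : ∀ {d} → (Fin d → ℤ) → (Fin d → ℤ) → (Fin d → ℤ)
(m ⊕ v) j = m j + v j

offTerm : ∀ {d} → (Fin d → ℤ) → Fin d → Fin d → ℤ
offTerm m i j with j ≟ i
... | yes _ = 0ℤ
... | no  _ = + ∣ m i - m j ∣

C : ∀ {d} → (Fin d → ℤ) → ℤ
C {d} m = minFin d (λ i → sumFin d (offTerm m i))

{-# OPTIONS --safe #-}
-- C(m) is the minimum, over the coordinates of m, of the convex piecewise-linear
-- function dist m x = Σ_j |x - m_j|, whose slope just right of x is 2·#{j | m_j ≤ x} - d
-- and just left of x is 2·#{j | m_j < x} - d.  Counting in the sorted vector shows that
-- these slopes change sign at the lower median m̃_{M-1}, so it minimises dist m over all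
-- of ℤ and C(m) = dist m m̃_{M-1}.  Raising m_i by one adds 1 to dist m at every x ≤ m_i
-- and subtracts 1 at every x > m_i; the three cases come from comparing the minimum of
-- the perturbed function with its values at suitable coordinates.
module Submission where

open import Defs
open import Data.Nat as ℕ using (ℕ; zero; suc; _/_; _%_; _∸_)
import Data.Nat.Properties as ℕₚ
open import Data.Nat.DivMod using (m/n≡1+[m∸n]/n; m≥n⇒m/n>0; m%n<n)
open import Data.Integer
  using (ℤ; +_; -[1+_]; _+_; _-_; -_; _*_; ∣_∣; _≤_; _<_; _≤?_; _<?_; +≤+; -≤+;
         NonNegative; nonNegative; nonPositive; 0ℤ; 1ℤ; -1ℤ)
open import Data.Integer.Properties
open import Data.Integer.Tactic.RingSolver using (solve-∀)
open import Data.Fin as Fin using (Fin; zero; suc; toℕ)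
import Data.Fin.Properties as Finₚ
open import Data.Fin.Permutation using (inverseʳ)
open import Data.Product using (_×_; _,_)
open import Data.Sum using (_⊎_; inj₁; inj₂)
open import Function.Base using (_∘_; id)
open import Function.Bundles using (_↔_; Inverse; Injection)
open import Function.Properties.Inverse using (↔⇒↣)
open import Relation.Binary.PropositionalEquality
open import Relation.Nullary using (Dec; yes; no; ¬_; contradiction)
import Algebra.Properties.CommutativeMonoid.Sum as CommutativeMonoidSum

module Σ = CommutativeMonoidSum +-0-commutativeMonoid

sumFin≡sum : ∀ n (f : Fin n → ℤ) → sumFin n f ≡ Σ.sum f
sumFin≡sum zero    f = refl
sumFin≡sum (suc n) f = cong (_+_ (f zero)) (sumFin≡sum n (f ∘ suc))

sumFin-permute : ∀ n (f : Fin n → ℤ) (σ : Fin n ↔ Fin n) →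
                 sumFin n f ≡ sumFin n (f ∘ Inverse.to σ)
sumFin-permute n f σ = begin
  sumFin n f                    ≡⟨ sumFin≡sum n f ⟩
  Σ.sum f                       ≡⟨ Σ.sum-permute f σ ⟩
  Σ.sum (f ∘ Inverse.to σ)      ≡⟨ sumFin≡sum n (f ∘ Inverse.to σ) ⟨
  sumFin n (f ∘ Inverse.to σ)   ∎
  where open ≡-Reasoning

sumFin-cong : ∀ n {f g : Fin n → ℤ} → (∀ j → f j ≡ g j) → sumFin n f ≡ sumFin n g
sumFin-cong zero    f≗g = refl
sumFin-cong (suc n) f≗g = cong₂ _+_ (f≗g zero) (sumFin-cong n (f≗g ∘ suc))

sumFin-mono-≤ : ∀ n {f g : Fin n → ℤ} → (∀ j → f j ≤ g j) → sumFin n f ≤ sumFin n g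
sumFin-mono-≤ zero    f≤g = ≤-refl
sumFin-mono-≤ (suc n) f≤g = +-mono-≤ (f≤g zero) (sumFin-mono-≤ n (f≤g ∘ suc))

sumFin-distrib-+ : ∀ n (f g : Fin n → ℤ) →
                   sumFin n (λ j → f j + g j) ≡ sumFin n f + sumFin n g
sumFin-distrib-+ zero    f g = refl
sumFin-distrib-+ (suc n) f g = trans
  (cong (_+_ (f zero + g zero)) (sumFin-distrib-+ n (f ∘ suc) (g ∘ suc)))
  (interchange (f zero) (g zero) _ _)
  where
  interchange : ∀ a b c d → (a + b) + (c + d) ≡ (a + c) + (b + d)
  interchange = solve-∀

sumFin-distribʳ-* : ∀ n (f : Fin n → ℤ) t → sumFin n (λ j → f j * t) ≡ sumFin n f * t
sumFin-distribʳ-* zero    f t = refl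
sumFin-distribʳ-* (suc n) f t = trans
  (cong (_+_ (f zero * t)) (sumFin-distribʳ-* n (f ∘ suc) t))
  (sym (*-distribʳ-+ t (f zero) _))

sumFin-affine : ∀ n (f : Fin n → ℤ) →
                sumFin n (λ j → + 2 * f j - 1ℤ) ≡ + 2 * sumFin n f - + n
sumFin-affine zero    f = refl
sumFin-affine (suc n) f = trans
  (cong (_+_ (+ 2 * f zero - 1ℤ)) (sumFin-affine n (f ∘ suc)))
  (regroup (f zero) (sumFin n (f ∘ suc)) (+ n))
  where
  regroup : ∀ a s k → (+ 2 * a - 1ℤ) + (+ 2 * s - k) ≡ + 2 * (a + s) - (1ℤ + k)
  regroup = solve-∀

sumFin-update : ∀ n (f g : Fin n → ℤ) i → (∀ j → j ≢ i → f j ≡ g j) →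
                sumFin n f ≡ sumFin n g + (f i - g i)
sumFin-update (suc n) f g zero f≗g = trans
  (cong (_+_ (f zero)) (sumFin-cong n (λ j → f≗g (suc j) λ ())))
  (regroup (f zero) (g zero) _)
  where
  regroup : ∀ a b s → a + s ≡ (b + s) + (a - b)
  regroup = solve-∀
sumFin-update (suc n) f g (suc i) f≗g = trans
  (cong₂ _+_ (f≗g zero λ ()) (sumFin-update n (f ∘ suc) (g ∘ suc) i
    (λ j j≢i → f≗g (suc j) (j≢i ∘ Finₚ.suc-injective))))
  (sym (+-assoc (g zero) _ _))

indicator : ∀ {p} {P : Set p} → Dec P → ℤ
indicator (yes _) = 1ℤ
indicator (no  _) = 0ℤ

indicator-mono : ∀ {p q} {P : Set p} {Q : Set q} (P? : Dec P) (Q? : Dec Q) →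
                 (P → Q) → indicator P? ≤ indicator Q?
indicator-mono (yes _) (yes _) _   = ≤-refl
indicator-mono (yes p) (no ¬q) P⇒Q = contradiction (P⇒Q p) ¬q
indicator-mono (no  _) (yes _) _   = +≤+ ℕ.z≤n
indicator-mono (no  _) (no  _) _   = ≤-refl

count : ∀ {n p} {P : Fin n → Set p} → (∀ j → Dec (P j)) → ℤ
count {n} P? = sumFin n (indicator ∘ P?)

count-mono : ∀ {n p q} {P : Fin n → Set p} {Q : Fin n → Set q}
             (P? : ∀ j → Dec (P j)) (Q? : ∀ j → Dec (Q j)) →
             (∀ j → P j → Q j) → count P? ≤ count Q?
count-mono {n} P? Q? P⇒Q = sumFin-mono-≤ n (λ j → indicator-mono (P? j) (Q? j) (P⇒Q j))

count-prefix : ∀ n k → k ℕ.≤ n → count {n} (λ j → toℕ j ℕ.<? k) ≡ + k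
count-prefix zero    zero    _ = refl
count-prefix (suc n) zero    _ = trans (+-identityˡ _) (count-prefix n zero ℕ.z≤n)
count-prefix (suc n) (suc k) (ℕ.s≤s k≤n) = cong (_+_ 1ℤ) (trans
  (sumFin-cong n λ j → ≤-antisym
    (indicator-mono (suc (toℕ j) ℕ.<? suc k) (toℕ j ℕ.<? k) ℕₚ.≤-pred)
    (indicator-mono (toℕ j ℕ.<? k) (suc (toℕ j) ℕ.<? suc k) ℕ.s≤s))
  (count-prefix n k k≤n))

dist : ∀ {n} → (Fin n → ℤ) → ℤ → ℤ
dist {n} m x = sumFin n (λ j → + ∣ x - m j ∣)

≤-∣∣ : ∀ i → i ≤ + ∣ i ∣
≤-∣∣ (+ _)    = ≤-refl
≤-∣∣ -[1+ _ ] = -≤+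

i<j⇒i+1≤j : ∀ {i j} → i < j → i + 1ℤ ≤ j
i<j⇒i+1≤j {i} i<j = ≤-trans (≤-reflexive (+-comm i 1ℤ)) (i<j⇒suc[i]≤j i<j)

∣-∣-≥ : ∀ {i j} → j ≤ i → + ∣ i - j ∣ ≡ i - j
∣-∣-≥ {i} {j} j≤i = trans (cong +_ (∣i-j∣≡∣j-i∣ i j)) (∣-∣-≤ j≤i)

-- + 2 * indicator P? - 1ℤ is the slope ±1 of a supporting line of ∣ · - c ∣ at y.
∣-∣-tangent : ∀ {p} {P : Set p} (P? : Dec P) {c y} → (P → c ≤ y) → (¬ P → y ≤ c) →
              ∀ x → + ∣ y - c ∣ + (+ 2 * indicator P? - 1ℤ) * (x - y) ≤ + ∣ x - c ∣
∣-∣-tangent (yes p) {c} {y} c≤y _ x = begin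
  + ∣ y - c ∣ + 1ℤ * (x - y)  ≡⟨ cong (λ z → z + 1ℤ * (x - y)) (∣-∣-≥ (c≤y p)) ⟩
  (y - c) + 1ℤ * (x - y)      ≡⟨ telescope y c x ⟩
  x - c                       ≤⟨ ≤-∣∣ (x - c) ⟩
  + ∣ x - c ∣                 ∎
  where
  open ≤-Reasoning
  telescope : ∀ y c x → (y - c) + 1ℤ * (x - y) ≡ x - c
  telescope = solve-∀
∣-∣-tangent (no ¬p) {c} {y} _ y≤c x = begin
  + ∣ y - c ∣ + -1ℤ * (x - y)  ≡⟨ cong (λ z → z + -1ℤ * (x - y)) (∣-∣-≤ (y≤c ¬p)) ⟩
  (c - y) + -1ℤ * (x - y)      ≡⟨ telescope y c x ⟩
  c - x                        ≤⟨ ≤-∣∣ (c - x) ⟩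
  + ∣ c - x ∣                  ≡⟨ cong +_ (∣i-j∣≡∣j-i∣ c x) ⟩
  + ∣ x - c ∣                  ∎
  where
  open ≤-Reasoning
  telescope : ∀ y c x → (c - y) + -1ℤ * (x - y) ≡ c - x
  telescope = solve-∀

dist-tangent : ∀ {n p} (m : Fin n → ℤ) {P : Fin n → Set p} (P? : ∀ j → Dec (P j)) {y} →
               (∀ j → P j → m j ≤ y) → (∀ j → ¬ P j → y ≤ m j) →
               ∀ x → dist m y + (+ 2 * count P? - + n) * (x - y) ≤ dist m x
dist-tangent {n} m P? {y} below above x = begin
  dist m y + (+ 2 * count P? - + n) * (x - y)
    ≡⟨ cong (λ s → dist m y + s * (x - y)) (sumFin-affine n (indicator ∘ P?)) ⟨
  dist m y + sumFin n slope * (x - y)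
    ≡⟨ cong (_+_ (dist m y)) (sumFin-distribʳ-* n slope (x - y)) ⟨
  dist m y + sumFin n (λ j → slope j * (x - y))
    ≡⟨ sumFin-distrib-+ n (λ j → + ∣ y - m j ∣) (λ j → slope j * (x - y)) ⟨
  sumFin n (λ j → + ∣ y - m j ∣ + slope j * (x - y))
    ≤⟨ sumFin-mono-≤ n (λ j → ∣-∣-tangent (P? j) (below j) (above j) x) ⟩
  dist m x ∎
  where
  open ≤-Reasoning
  slope : Fin n → ℤ
  slope j = + 2 * indicator (P? j) - 1ℤ

slope⁺ slope⁻ : ∀ {n} → (Fin n → ℤ) → ℤ → ℤ
slope⁺ {n} m y = + 2 * count (λ j → m j ≤? y) - + n
slope⁻ {n} m y = + 2 * count (λ j → m j <? y) - + n

dist-tangent⁺ : ∀ {n} (m : Fin n → ℤ) y x → dist m y + slope⁺ m y * (x - y) ≤ dist m x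
dist-tangent⁺ m y = dist-tangent m (λ j → m j ≤? y) (λ _ → id) (λ _ → <⇒≤ ∘ ≰⇒>)

dist-tangent⁻ : ∀ {n} (m : Fin n → ℤ) y x → dist m y + slope⁻ m y * (x - y) ≤ dist m x
dist-tangent⁻ m y = dist-tangent m (λ j → m j <? y) (λ _ → <⇒≤) (λ _ → ≮⇒≥)

nonNeg-* : ∀ {i j} → 0ℤ ≤ i → 0ℤ ≤ j → 0ℤ ≤ i * j
nonNeg-* {i} 0≤i 0≤j = ≤-trans (≤-reflexive (sym (*-zeroʳ i))) (*-monoˡ-≤-nonNeg i {{nonNegative 0≤i}} 0≤j)

nonPos-* : ∀ {i j} → i ≤ 0ℤ → j ≤ 0ℤ → 0ℤ ≤ i * j
nonPos-* {i} i≤0 j≤0 = ≤-trans (≤-reflexive (sym (*-zeroʳ i))) (*-monoˡ-≤-nonPos i {{nonPositive i≤0}} j≤0)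

dist-minimum : ∀ {n} (m : Fin n → ℤ) {y} → 0ℤ ≤ slope⁺ m y → slope⁻ m y ≤ 0ℤ →
               ∀ x → dist m y ≤ dist m x
dist-minimum m {y} 0≤s⁺ s⁻≤0 x with ≤-total y x
... | inj₁ y≤x = ≤-trans (i≤i+j _ _ {{nonNegative (nonNeg-* 0≤s⁺ (i≤j⇒0≤j-i y≤x))}}) (dist-tangent⁺ m y x)
... | inj₂ x≤y = ≤-trans (i≤i+j _ _ {{nonNegative (nonPos-* s⁻≤0 (i≤j⇒i-j≤0 x≤y))}}) (dist-tangent⁻ m y x)

dist-rise : ∀ {n} (m : Fin n → ℤ) {y x k} → y < x → 0ℤ ≤ k → k ≤ slope⁺ m y →
            dist m y + k ≤ dist m x
dist-rise m {y} {x} {k} y<x 0≤k k≤s = begin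
  dist m y + k                     ≡⟨ cong (_+_ (dist m y)) (*-identityʳ k) ⟨
  dist m y + k * 1ℤ                ≤⟨ +-monoʳ-≤ (dist m y) (*-monoˡ-≤-nonNeg k {{nonNegative 0≤k}} 1≤x-y) ⟩
  dist m y + k * (x - y)           ≤⟨ +-monoʳ-≤ (dist m y) (*-monoʳ-≤-nonNeg (x - y) {{0≤x-y}} k≤s) ⟩
  dist m y + slope⁺ m y * (x - y)  ≤⟨ dist-tangent⁺ m y x ⟩
  dist m x                         ∎
  where
  open ≤-Reasoning
  cancel : ∀ y → (y + 1ℤ) - y ≡ 1ℤ
  cancel = solve-∀
  1≤x-y : 1ℤ ≤ x - y
  1≤x-y = ≤-trans (≤-reflexive (sym (cancel y))) (+-monoˡ-≤ (- y) (i<j⇒i+1≤j y<x))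
  0≤x-y : NonNegative (x - y)
  0≤x-y = nonNegative (≤-trans (+≤+ ℕ.z≤n) 1≤x-y)

dist-succ-≤ : ∀ {n} (m : Fin n → ℤ) y → dist m (y + 1ℤ) ≤ dist m y + slope⁻ m (y + 1ℤ)
dist-succ-≤ m y = begin
  dist m (y + 1ℤ)                              ≡⟨ rearrange (dist m (y + 1ℤ)) s y ⟩
  (dist m (y + 1ℤ) + s * (y - (y + 1ℤ))) + s  ≤⟨ +-monoˡ-≤ s (dist-tangent⁻ m (y + 1ℤ) y) ⟩
  dist m y + s                                 ∎
  where
  open ≤-Reasoning
  s : ℤ
  s = slope⁻ m (y + 1ℤ)
  rearrange : ∀ a s y → a ≡ (a + s * (y - (y + 1ℤ))) + s
  rearrange = solve-∀

minFin-≤ : ∀ n (f : Fin n → ℤ) k → minFin n f ≤ f k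
minFin-≤ (suc zero)    f zero    = ≤-refl
minFin-≤ (suc (suc n)) f zero    = i⊓j≤i (f zero) _
minFin-≤ (suc (suc n)) f (suc k) = ≤-trans (i⊓j≤j (f zero) _) (minFin-≤ (suc n) (f ∘ suc) k)

minFin-glb : ∀ n (f : Fin n → ℤ) → Fin n → ∀ {c} → (∀ k → c ≤ f k) → c ≤ minFin n f
minFin-glb (suc zero)    f _ c≤f = c≤f zero
minFin-glb (suc (suc n)) f _ c≤f = ⊓-glb (c≤f zero) (minFin-glb (suc n) (f ∘ suc) zero (c≤f ∘ suc))

offTerm≡ : ∀ {n} (m : Fin n → ℤ) i j → offTerm m i j ≡ + ∣ m i - m j ∣
offTerm≡ m i j with j Fin.≟ i
... | yes refl = cong (λ z → + ∣ z ∣) (sym (+-inverseʳ (m j)))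
... | no  _    = refl

C-≤-dist : ∀ {n} (m : Fin n → ℤ) k → C m ≤ dist m (m k)
C-≤-dist {n} m k = ≤-trans (minFin-≤ n _ k) (≤-reflexive (sumFin-cong n (offTerm≡ m k)))

-- The point of Fin n only witnesses that the minimum is taken over a nonempty set.
≤-C : ∀ {n} (m : Fin n → ℤ) → Fin n → ∀ {c} → (∀ k → c ≤ dist m (m k)) → c ≤ C m
≤-C {n} m k₀ c≤dist = minFin-glb n _ k₀ λ k →
  ≤-trans (c≤dist k) (≤-reflexive (sym (sumFin-cong n (offTerm≡ m k))))

e-diag : ∀ {n} (i : Fin n) → e i i ≡ 1ℤ
e-diag i with i Fin.≟ i
... | yes _   = refl
... | no  i≢i = contradiction refl i≢i

e-offDiag : ∀ {n} {i j : Fin n} → j ≢ i → e i j ≡ 0ℤ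
e-offDiag {i = i} {j} j≢i with j Fin.≟ i
... | yes j≡i = contradiction j≡i j≢i
... | no  _   = refl

⊕-e-diag : ∀ {n} (m : Fin n → ℤ) i → (m ⊕ e i) i ≡ m i + 1ℤ
⊕-e-diag m i = cong (_+_ (m i)) (e-diag i)

⊕-e-offDiag : ∀ {n} (m : Fin n → ℤ) {i j} → j ≢ i → (m ⊕ e i) j ≡ m j
⊕-e-offDiag m {j = j} j≢i = trans (cong (_+_ (m j)) (e-offDiag j≢i)) (+-identityʳ (m j))

dist-⊕-e : ∀ {n} (m : Fin n → ℤ) i x →
           dist (m ⊕ e i) x ≡ dist m x + (+ ∣ x - (m i + 1ℤ) ∣ - + ∣ x - m i ∣)
dist-⊕-e {n} m i x = trans
  (sumFin-update n _ _ i (λ j j≢i → cong (λ z → + ∣ x - z ∣) (⊕-e-offDiag m j≢i)))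
  (cong (λ z → dist m x + (+ ∣ x - z ∣ - + ∣ x - m i ∣)) (⊕-e-diag m i))

dist-⊕-e-≤ : ∀ {n} (m : Fin n → ℤ) i {x} → x ≤ m i → dist (m ⊕ e i) x ≡ dist m x + 1ℤ
dist-⊕-e-≤ m i {x} x≤mᵢ = trans (dist-⊕-e m i x) (cong (_+_ (dist m x)) (begin
  + ∣ x - (m i + 1ℤ) ∣ - + ∣ x - m i ∣  ≡⟨ cong₂ _-_ (∣-∣-≤ (≤-trans x≤mᵢ (i≤i+j (m i) 1ℤ))) (∣-∣-≤ x≤mᵢ) ⟩
  (m i + 1ℤ - x) - (m i - x)            ≡⟨ cancel (m i) x ⟩
  1ℤ                                    ∎))
  where
  open ≡-Reasoning
  cancel : ∀ a x → (a + 1ℤ - x) - (a - x) ≡ 1ℤ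
  cancel = solve-∀

dist-⊕-e-> : ∀ {n} (m : Fin n → ℤ) i {x} → m i < x → dist (m ⊕ e i) x ≡ dist m x - 1ℤ
dist-⊕-e-> m i {x} mᵢ<x = trans (dist-⊕-e m i x) (cong (_+_ (dist m x)) (begin
  + ∣ x - (m i + 1ℤ) ∣ - + ∣ x - m i ∣  ≡⟨ cong₂ _-_ (∣-∣-≥ (i<j⇒i+1≤j mᵢ<x)) (∣-∣-≥ (<⇒≤ mᵢ<x)) ⟩
  (x - (m i + 1ℤ)) - (x - m i)          ≡⟨ cancel (m i) x ⟩
  -1ℤ                                   ∎))
  where
  open ≡-Reasoning
  cancel : ∀ a x → (x - (a + 1ℤ)) - (x - a) ≡ -1ℤ
  cancel = solve-∀

≤-C-⊕-e : ∀ {n} (m : Fin n → ℤ) i {c} →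
          (∀ x → x ≤ m i → c ≤ dist m x + 1ℤ) → (∀ x → m i < x → c ≤ dist m x - 1ℤ) →
          c ≤ C (m ⊕ e i)
≤-C-⊕-e m i {c} below above = ≤-C (m ⊕ e i) i (λ k → bound ((m ⊕ e i) k))
  where
  bound : ∀ x → c ≤ dist (m ⊕ e i) x
  bound x with x ≤? m i
  ... | yes x≤mᵢ = ≤-trans (below x x≤mᵢ) (≤-reflexive (sym (dist-⊕-e-≤ m i x≤mᵢ)))
  ... | no  x≰mᵢ = ≤-trans (above x (≰⇒> x≰mᵢ)) (≤-reflexive (sym (dist-⊕-e-> m i (≰⇒> x≰mᵢ))))

C-⊕-e-≤-below : ∀ {n} (m : Fin n → ℤ) {i j} → j ≢ i → m j ≤ m i →
                C (m ⊕ e i) ≤ dist m (m j) + 1ℤ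
C-⊕-e-≤-below m {i} {j} j≢i mⱼ≤mᵢ = begin
  C (m ⊕ e i)                    ≤⟨ C-≤-dist (m ⊕ e i) j ⟩
  dist (m ⊕ e i) ((m ⊕ e i) j)   ≡⟨ cong (dist (m ⊕ e i)) (⊕-e-offDiag m j≢i) ⟩
  dist (m ⊕ e i) (m j)           ≡⟨ dist-⊕-e-≤ m i mⱼ≤mᵢ ⟩
  dist m (m j) + 1ℤ              ∎
  where open ≤-Reasoning

C-⊕-e-≤-above : ∀ {n} (m : Fin n → ℤ) {i j} → m i < m j → C (m ⊕ e i) ≤ dist m (m j) - 1ℤ
C-⊕-e-≤-above m {i} {j} mᵢ<mⱼ = begin
  C (m ⊕ e i)                    ≤⟨ C-≤-dist (m ⊕ e i) j ⟩
  dist (m ⊕ e i) ((m ⊕ e i) j)   ≡⟨ cong (dist (m ⊕ e i)) (⊕-e-offDiag m j≢i) ⟩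
  dist (m ⊕ e i) (m j)           ≡⟨ dist-⊕-e-> m i mᵢ<mⱼ ⟩
  dist m (m j) - 1ℤ              ∎
  where
  open ≤-Reasoning
  j≢i : j ≢ i
  j≢i refl = <-irrefl refl mᵢ<mⱼ

C-⊕-e-≤-diag : ∀ {n} (m : Fin n → ℤ) i → C (m ⊕ e i) ≤ dist m (m i + 1ℤ) - 1ℤ
C-⊕-e-≤-diag m i = begin
  C (m ⊕ e i)                    ≤⟨ C-≤-dist (m ⊕ e i) i ⟩
  dist (m ⊕ e i) ((m ⊕ e i) i)   ≡⟨ cong (dist (m ⊕ e i)) (⊕-e-diag m i) ⟩
  dist (m ⊕ e i) (m i + 1ℤ)      ≡⟨ dist-⊕-e-> m i (i<i+1 (m i)) ⟩
  dist m (m i + 1ℤ) - 1ℤ         ∎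
  where
  open ≤-Reasoning
  i<i+1 : ∀ x → x < x + 1ℤ
  i<i+1 x = suc[i]≤j⇒i<j (≤-reflexive (+-comm 1ℤ x))

module Sorted {n} (m mt : Fin n → ℤ) (σ : Fin n ↔ Fin n)
  (mt≡ : ∀ j → mt j ≡ m (Inverse.to σ j)) (sorted : ∀ j k → j Fin.≤ k → mt j ≤ mt k) where

  count-sorted : ∀ {p} {P : ℤ → Set p} (P? : ∀ y → Dec (P y)) → count (P? ∘ m) ≡ count (P? ∘ mt)
  count-sorted P? = trans (sumFin-permute n _ σ) (sumFin-cong n (λ k → cong (indicator ∘ P?) (sym (mt≡ k))))

  slope⁺-≥ : ∀ K {y} → mt K ≤ y → + 2 * + suc (toℕ K) - + n ≤ slope⁺ m y
  slope⁺-≥ K {y} mtK≤y = +-monoˡ-≤ (- + n) (*-monoˡ-≤-nonNeg (+ 2) (begin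
    + suc (toℕ K)                             ≡⟨ count-prefix n (suc (toℕ K)) (Finₚ.toℕ<n K) ⟨
    count {n} (λ k → toℕ k ℕ.<? suc (toℕ K))  ≤⟨ count-mono _ _ k≤K⇒mtₖ≤y ⟩
    count (λ k → mt k ≤? y)                   ≡⟨ count-sorted (_≤? y) ⟨
    count (λ j → m j ≤? y)                    ∎))
    where
    open ≤-Reasoning
    k≤K⇒mtₖ≤y : ∀ k → toℕ k ℕ.< suc (toℕ K) → mt k ≤ y
    k≤K⇒mtₖ≤y k k≤K = ≤-trans (sorted k K (ℕₚ.≤-pred k≤K)) mtK≤y

  slope⁻-≤ : ∀ K {y} → y ≤ mt K → slope⁻ m y ≤ + 2 * + toℕ K - + n
  slope⁻-≤ K {y} y≤mtK = +-monoˡ-≤ (- + n) (*-monoˡ-≤-nonNeg (+ 2) (begin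
    count (λ j → m j <? y)              ≡⟨ count-sorted (_<? y) ⟩
    count (λ k → mt k <? y)             ≤⟨ count-mono _ _ mtₖ<y⇒k<K ⟩
    count {n} (λ k → toℕ k ℕ.<? toℕ K)  ≡⟨ count-prefix n (toℕ K) (ℕₚ.<⇒≤ (Finₚ.toℕ<n K)) ⟩
    + toℕ K                             ∎))
    where
    open ≤-Reasoning
    mtₖ<y⇒k<K : ∀ k → mt k < y → toℕ k ℕ.< toℕ K
    mtₖ<y⇒k<K k mtₖ<y = ℕₚ.≰⇒> λ K≤k → <⇒≱ mtₖ<y (≤-trans y≤mtK (sorted K k K≤k))

twice-half-suc : ∀ d → 2 ℕ.* ((d ℕ.+ 1) / 2) ≡ d ℕ.+ d % 2
twice-half-suc 0             = refl
twice-half-suc 1             = refl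
twice-half-suc (suc (suc d)) = begin
  2 ℕ.* ((suc (suc d) ℕ.+ 1) / 2)
    ≡⟨ cong (2 ℕ.*_) (m/n≡1+[m∸n]/n {suc (suc d) ℕ.+ 1} (ℕ.s≤s (ℕ.s≤s ℕ.z≤n))) ⟩
  2 ℕ.* suc ((d ℕ.+ 1) / 2)      ≡⟨ ℕₚ.*-suc 2 ((d ℕ.+ 1) / 2) ⟩
  2 ℕ.+ 2 ℕ.* ((d ℕ.+ 1) / 2)    ≡⟨ cong (2 ℕ.+_) (twice-half-suc d) ⟩
  2 ℕ.+ (d ℕ.+ d % 2)            ∎
  where open ≡-Reasoning

parity : ∀ d → d % 2 ≡ 0 ⊎ d % 2 ≡ 1
parity 0             = inj₁ refl
parity 1             = inj₂ refl
parity (suc (suc d)) = parity d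

i≡j+k⇒i-j≡k : ∀ {i j k} → i ≡ j + k → i - j ≡ k
i≡j+k⇒i-j≡k {j = j} {k} refl = cancel j k
  where
  cancel : ∀ j k → (j + k) - j ≡ k
  cancel = solve-∀

-- a and b are the 0-based indices of m̃_M and m̃_{M-1}; excess = 2a - d is the parity of d.
module Median (d : ℕ) (d≥2 : 2 ℕ.≤ d) (m mt : Fin d → ℤ) (σ : Fin d ↔ Fin d)
  (mt≡ : ∀ j → mt j ≡ m (Inverse.to σ j)) (sorted : ∀ j k → j Fin.≤ k → mt j ≤ mt k)
  (a b : Fin d) (a≡ : toℕ a ≡ (d ℕ.+ 1) / 2) (b≡ : toℕ b ≡ ((d ℕ.+ 1) / 2) ∸ 1) where

  open Sorted m mt σ mt≡ sorted

  to : Fin d → Fin d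
  to = Inverse.to σ

  a≡suc-b : toℕ a ≡ suc (toℕ b)
  a≡suc-b = begin
    toℕ a                          ≡⟨ a≡ ⟩
    (d ℕ.+ 1) / 2                  ≡⟨ ℕₚ.suc-pred ((d ℕ.+ 1) / 2) {{ℕ.>-nonZero half>0}} ⟨
    suc (((d ℕ.+ 1) / 2) ∸ 1)      ≡⟨ cong suc b≡ ⟨
    suc (toℕ b)                    ∎
    where
    open ≡-Reasoning
    half>0 : 0 ℕ.< (d ℕ.+ 1) / 2
    half>0 = m≥n⇒m/n>0 (ℕₚ.≤-trans d≥2 (ℕₚ.m≤m+n d 1))

  b≤a : b Fin.≤ a
  b≤a = ℕₚ.≤-trans (ℕₚ.n≤1+n (toℕ b)) (ℕₚ.≤-reflexive (sym a≡suc-b))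

  excess : ℤ
  excess = + 2 * + toℕ a - + d

  excess≡parity : excess ≡ + (d % 2)
  excess≡parity = begin
    + 2 * + toℕ a - + d                  ≡⟨ cong (λ k → k - + d) (pos-* 2 (toℕ a)) ⟨
    + (2 ℕ.* toℕ a) - + d                ≡⟨ cong (λ k → + (2 ℕ.* k) - + d) a≡ ⟩
    + (2 ℕ.* ((d ℕ.+ 1) / 2)) - + d      ≡⟨ cong (λ k → + k - + d) (twice-half-suc d) ⟩
    + (d ℕ.+ d % 2) - + d                ≡⟨ cancel (d % 2) ⟩
    + (d % 2)                            ∎
    where
    open ≡-Reasoning
    cancel : ∀ r → + (d ℕ.+ r) - + d ≡ + r
    cancel r = trans (cong (_- + d) (pos-+ d r)) (cancelˡ (+ d) (+ r))
      where
      cancelˡ : ∀ x y → (x + y) - x ≡ y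
      cancelˡ = solve-∀

  0≤excess : 0ℤ ≤ excess
  0≤excess = ≤-trans (+≤+ ℕ.z≤n) (≤-reflexive (sym excess≡parity))

  excess≤1 : excess ≤ 1ℤ
  excess≤1 = ≤-trans (≤-reflexive excess≡parity) (+≤+ (ℕₚ.≤-pred (m%n<n d 2)))

  med : ℤ
  med = mt b

  slope⁺-mt-b : excess ≤ slope⁺ m med
  slope⁺-mt-b = ≤-trans (≤-reflexive (cong (λ k → + 2 * + k - + d) a≡suc-b)) (slope⁺-≥ b ≤-refl)

  slope⁻-mt-b : slope⁻ m med ≤ excess - + 2
  slope⁻-mt-b = ≤-trans (slope⁻-≤ b ≤-refl) (≤-reflexive (begin
    + 2 * + toℕ b - + d                ≡⟨ shift (+ toℕ b) (+ d) ⟩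
    (+ 2 * + suc (toℕ b) - + d) - + 2  ≡⟨ cong (λ k → (+ 2 * + k - + d) - + 2) a≡suc-b ⟨
    excess - + 2                       ∎))
    where
    open ≡-Reasoning
    shift : ∀ B D → + 2 * B - D ≡ (+ 2 * (1ℤ + B) - D) - + 2
    shift = solve-∀

  slope⁺-mt-a : ∀ {y} → mt a ≤ y → excess + + 2 ≤ slope⁺ m y
  slope⁺-mt-a mta≤y = ≤-trans (≤-reflexive (shift (+ toℕ a) (+ d))) (slope⁺-≥ a mta≤y)
    where
    shift : ∀ A D → (+ 2 * A - D) + + 2 ≡ + 2 * (1ℤ + A) - D
    shift = solve-∀

  dist-med-minimum : ∀ x → dist m med ≤ dist m x
  dist-med-minimum = dist-minimum m (≤-trans 0≤excess slope⁺-mt-b)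
    (≤-trans slope⁻-mt-b (i≤j⇒i-j≤0 (≤-trans excess≤1 (+≤+ (ℕ.s≤s ℕ.z≤n)))))

  C≡dist-med : C m ≡ dist m med
  C≡dist-med = ≤-antisym
    (≤-trans (C-≤-dist m (to b)) (≤-reflexive (cong (dist m) (sym (mt≡ b)))))
    (≤-C m b (λ k → dist-med-minimum (m k)))

  C-⊕-e-≥-upper : ∀ i → mt a ≤ m i → C (m ⊕ e i) ≡ C m + 1ℤ
  C-⊕-e-≥-upper i mta≤mᵢ = trans (≤-antisym upper lower) (cong (_+ 1ℤ) (sym C≡dist-med))
    where
    lower : dist m med + 1ℤ ≤ C (m ⊕ e i)
    lower = ≤-C-⊕-e m i (λ x _ → +-monoˡ-≤ 1ℤ (dist-med-minimum x)) λ x mᵢ<x → begin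
      dist m med + 1ℤ              ≡⟨ shift (dist m med) ⟩
      (dist m med + + 2) - 1ℤ      ≤⟨ +-monoˡ-≤ -1ℤ (+-monoˡ-≤ (+ 2) (dist-med-minimum (mt a))) ⟩
      (dist m (mt a) + + 2) - 1ℤ   ≤⟨ +-monoˡ-≤ -1ℤ (dist-rise m (≤-<-trans mta≤mᵢ mᵢ<x) (+≤+ ℕ.z≤n) 2≤slope) ⟩
      dist m x - 1ℤ                ∎
      where
      open ≤-Reasoning
      2≤slope : + 2 ≤ slope⁺ m (mt a)
      2≤slope = ≤-trans (i≤j+i (+ 2) excess {{nonNegative 0≤excess}}) (slope⁺-mt-a ≤-refl)
      shift : ∀ z → z + 1ℤ ≡ (z + + 2) - 1ℤ
      shift = solve-∀
    upper : C (m ⊕ e i) ≤ dist m med + 1ℤ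
    upper with to b Fin.≟ i
    ... | no  b≢i = ≤-trans (C-⊕-e-≤-below m b≢i (≤-trans (≤-reflexive (sym (mt≡ b))) med≤mᵢ))
                            (≤-reflexive (cong (λ z → dist m z + 1ℤ) (sym (mt≡ b))))
      where
      med≤mᵢ : med ≤ m i
      med≤mᵢ = ≤-trans (sorted b a b≤a) mta≤mᵢ
    ... | yes b≡i = ≤-trans (C-⊕-e-≤-below m a≢i (≤-trans (≤-reflexive (sym (mt≡ a))) mta≤mᵢ))
                            (≤-reflexive (cong (λ z → dist m z + 1ℤ) (trans (sym (mt≡ a)) mta≡med)))
      where
      a≢i : to a ≢ i
      a≢i toa≡i = ℕₚ.1+n≢n (trans (sym a≡suc-b)
        (cong toℕ (Injection.injective (↔⇒↣ σ) (trans toa≡i (sym b≡i)))))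
      mta≡med : mt a ≡ med
      mta≡med = ≤-antisym (≤-trans mta≤mᵢ (≤-reflexive (trans (cong m (sym b≡i)) (sym (mt≡ b)))))
                          (sorted b a b≤a)

  C-⊕-e-below-minimiser : ∀ i t → m i < mt t → dist m (mt t) ≡ dist m med →
                          C (m ⊕ e i) ≡ C m - 1ℤ
  C-⊕-e-below-minimiser i t mᵢ<mtₜ mtₜ-minimal =
    trans (≤-antisym upper lower) (cong (_- 1ℤ) (sym C≡dist-med))
    where
    upper : C (m ⊕ e i) ≤ dist m med - 1ℤ
    upper = ≤-trans (C-⊕-e-≤-above m (<-≤-trans mᵢ<mtₜ (≤-reflexive (mt≡ t))))
                    (≤-reflexive (cong (_- 1ℤ) (trans (cong (dist m) (sym (mt≡ t))) mtₜ-minimal)))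
    lower : dist m med - 1ℤ ≤ C (m ⊕ e i)
    lower = ≤-C-⊕-e m i
      (λ x _ → ≤-trans (i-j≤i (dist m med) 1ℤ) (≤-trans (dist-med-minimum x) (i≤i+j (dist m x) 1ℤ)))
      (λ x _ → +-monoˡ-≤ -1ℤ (dist-med-minimum x))

  dist-mt-a≡dist-med : d % 2 ≡ 0 → dist m (mt a) ≡ dist m med
  dist-mt-a≡dist-med even = ≤-antisym
    (dist-minimum m (≤-trans 0≤excess (≤-trans (i≤i+j excess (+ 2)) (slope⁺-mt-a ≤-refl)))
                    (≤-trans (slope⁻-≤ a ≤-refl) excess≤0) med)
    (dist-med-minimum (mt a))
    where
    excess≤0 : excess ≤ 0ℤ
    excess≤0 = ≤-reflexive (trans excess≡parity (cong +_ even))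

  C-⊕-e-<-median : ∀ i → (d % 2 ≡ 0 × m i < mt a) ⊎ (d % 2 ≡ 1 × m i < mt b) →
                   C (m ⊕ e i) ≡ C m - 1ℤ
  C-⊕-e-<-median i (inj₁ (even , mᵢ<mtₐ)) = C-⊕-e-below-minimiser i a mᵢ<mtₐ (dist-mt-a≡dist-med even)
  C-⊕-e-<-median i (inj₂ (_    , mᵢ<med)) = C-⊕-e-below-minimiser i b mᵢ<med refl

  C-⊕-e-lowerMedian : ∀ i → d % 2 ≡ 1 → m i ≡ med → med < mt a → C (m ⊕ e i) ≡ C m
  C-⊕-e-lowerMedian i odd mᵢ≡med med<mtₐ = trans (≤-antisym upper lower) (sym C≡dist-med)
    where
    excess≡1 : excess ≡ 1ℤ
    excess≡1 = trans excess≡parity (cong +_ odd)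
    cancel : ∀ z → z ≡ (z + 1ℤ) - 1ℤ
    cancel = solve-∀
    upper : C (m ⊕ e i) ≤ dist m med
    upper = begin
      C (m ⊕ e i)                            ≤⟨ C-⊕-e-≤-diag m i ⟩
      dist m (m i + 1ℤ) - 1ℤ                 ≡⟨ cong (λ z → dist m (z + 1ℤ) - 1ℤ) mᵢ≡med ⟩
      dist m (med + 1ℤ) - 1ℤ                 ≤⟨ +-monoˡ-≤ -1ℤ (dist-succ-≤ m med) ⟩
      (dist m med + slope⁻ m (med + 1ℤ)) - 1ℤ
        ≤⟨ +-monoˡ-≤ -1ℤ (+-monoʳ-≤ (dist m med)
             (≤-trans (slope⁻-≤ a (i<j⇒i+1≤j med<mtₐ)) (≤-reflexive excess≡1))) ⟩
      (dist m med + 1ℤ) - 1ℤ                 ≡⟨ cancel (dist m med) ⟨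
      dist m med                             ∎
      where open ≤-Reasoning
    lower : dist m med ≤ C (m ⊕ e i)
    lower = ≤-C-⊕-e m i
      (λ x _ → ≤-trans (dist-med-minimum x) (i≤i+j (dist m x) 1ℤ))
      (λ x mᵢ<x → ≤-trans (≤-reflexive (cancel (dist m med)))
        (+-monoˡ-≤ -1ℤ (dist-rise m (≤-<-trans (≤-reflexive (sym mᵢ≡med)) mᵢ<x) (+≤+ ℕ.z≤n)
          (≤-trans (≤-reflexive (sym excess≡1)) slope⁺-mt-b))))

  C-⊕-e-step : ∀ i → C (m ⊕ e i) - C m ≡ -1ℤ ⊎ C (m ⊕ e i) - C m ≡ 0ℤ ⊎ C (m ⊕ e i) - C m ≡ 1ℤ
  C-⊕-e-step i with mt a ≤? m i | parity d
  ... | yes mtₐ≤mᵢ | _         = inj₂ (inj₂ (i≡j+k⇒i-j≡k (C-⊕-e-≥-upper i mtₐ≤mᵢ)))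
  ... | no  mtₐ≰mᵢ | inj₁ even = inj₁ (i≡j+k⇒i-j≡k (C-⊕-e-<-median i (inj₁ (even , ≰⇒> mtₐ≰mᵢ))))
  ... | no  mtₐ≰mᵢ | inj₂ odd with m i <? med
  ...   | yes mᵢ<med = inj₁ (i≡j+k⇒i-j≡k (C-⊕-e-<-median i (inj₂ (odd , mᵢ<med))))
  ...   | no  mᵢ≮med = inj₂ (inj₁ (i≡j+k⇒i-j≡k
                            (trans (C-⊕-e-lowerMedian i odd mᵢ≡med med<mtₐ) (sym (+-identityʳ (C m))))))
    where
    k : Fin d
    k = Inverse.from σ i
    mᵢ≡mtₖ : m i ≡ mt k
    mᵢ≡mtₖ = sym (trans (mt≡ k) (cong m (inverseʳ σ)))
    k<a : toℕ k ℕ.< toℕ a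
    k<a = ℕₚ.≰⇒> λ a≤k → mtₐ≰mᵢ (≤-trans (sorted a k a≤k) (≤-reflexive (sym mᵢ≡mtₖ)))
    k≤b : k Fin.≤ b
    k≤b = ℕₚ.≤-pred (ℕₚ.≤-trans k<a (ℕₚ.≤-reflexive a≡suc-b))
    mᵢ≡med : m i ≡ med
    mᵢ≡med = ≤-antisym (≤-trans (≤-reflexive mᵢ≡mtₖ) (sorted k b k≤b)) (≮⇒≥ mᵢ≮med)
    med<mtₐ : med < mt a
    med<mtₐ = ≤-<-trans (≤-reflexive (sym mᵢ≡med)) (≰⇒> mtₐ≰mᵢ)

lemma8p3 : (d : ℕ) → 2 ℕ.≤ d → (m : Fin d → ℤ)
    → (mt : Fin d → ℤ) (σ : Fin d ↔ Fin d)
    → (∀ j → mt j ≡ m (Inverse.to σ j))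
    → (∀ j k → j Fin.≤ k → mt j ≤ mt k)
    → (a b : Fin d) → toℕ a ≡ (d ℕ.+ 1) / 2 → toℕ b ≡ ((d ℕ.+ 1) / 2) ∸ 1
    → (i : Fin d)
    → (mt a ≤ m i → C (m ⊕ e i) ≡ C m + 1ℤ)
      × ((d % 2 ≡ 0 × m i < mt a) ⊎ (d % 2 ≡ 1 × m i < mt b)
          → C (m ⊕ e i) ≡ C m - 1ℤ)
      × (d % 2 ≡ 1 → m i ≡ mt b → mt b < mt a → C (m ⊕ e i) ≡ C m)
      × (C (m ⊕ e i) - C m ≡ -1ℤ ⊎ C (m ⊕ e i) - C m ≡ 0ℤ ⊎ C (m ⊕ e i) - C m ≡ 1ℤ)
lemma8p3 d d≥2 m mt σ mt≡ sorted a b a≡ b≡ i =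
  C-⊕-e-≥-upper i , C-⊕-e-<-median i , C-⊕-e-lowerMedian i , C-⊕-e-step i
  where open Median d d≥2 m mt σ mt≡ sorted a b a≡ b≡
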